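{- The $\pi$-calculus with polyadic synchronization is not strongly replacement free: there exist a context $C$, an invisible process $I$ and a process $P$ of this calculus such that $C[I]\Downarrow$ but not $C[P]\Downarrow$.
   Context: The $\pi$-calculus with polyadic synchronization is the $\pi$-calculus in which subjects of input and output actions are tuples of names $\tilde a=\langle a_1,\dots,a_n\rangle$ (actions $\tilde a(x)$ and $\overline{\tilde a}\langle n\rangle$), with the same operational rules as the $\pi$-calculus except that an input and an output can synchronize only when their subject tuples coincide; input and output actions are visible and $\tau$ is invisible. A context is a term with one hole; $C[P]$ is hole filling. $\Rightarrow$ is the reflexive-transitive closure of $\xrightarrow{\tau}$; $P\Downarrow$ iff $P\Rightarrow\xrightarrow{\alpha}\Rightarrow P'$ for some visible $\alpha$ and $P'$; $P$ is invisible iff not $P\Downarrow$. -}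

module Defs where

-- π-calculus with polyadic synchronization, scoped de Bruijn syntax.
-- A process of type Proc n has its free names among Fin n.

open import Data.Nat using (ℕ; zero; suc)
open import Data.Fin using (Fin; zero; suc)
open import Data.List.NonEmpty using (List⁺) renaming (map to map⁺)
open import Data.Product using (Σ; ∃; _×_; _,_)
open import Data.Empty using (⊥)
open import Data.Unit using (⊤)
open import Relation.Nullary using (¬_)
open import Relation.Binary.Construct.Closure.ReflexiveTransitive using (Star)

-- Subject of an action: a (non-empty) tuple of names.
Tuple : ℕ → Set
Tuple n = List⁺ (Fin n)

data Proc (n : ℕ) : Set where
  nil  : Proc n
  tau  : Proc n → Proc n
  inp  : Tuple n → Proc (suc n) → Proc n          -- ã(x).P   (binds x = index 0)
  out  : Tuple n → Fin n → Proc n → Proc n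
  sum  : Proc n → Proc n → Proc n
  par  : Proc n → Proc n → Proc n
  res  : Proc (suc n) → Proc n                    -- (νx)P   (binds x = index 0)
  rep  : Proc n → Proc n

private variable
  n m k : ℕ

ext : (Fin n → Fin m) → Fin (suc n) → Fin (suc m)
ext ρ zero    = zero
ext ρ (suc i) = suc (ρ i)

ren : (Fin n → Fin m) → Proc n → Proc m
ren ρ nil         = nil
ren ρ (tau P)     = tau (ren ρ P)
ren ρ (inp a P)   = inp (map⁺ ρ a) (ren (ext ρ) P)
ren ρ (out a b P) = out (map⁺ ρ a) (ρ b) (ren ρ P)
ren ρ (sum P Q)   = sum (ren ρ P) (ren ρ Q)
ren ρ (par P Q)   = par (ren ρ P) (ren ρ Q)
ren ρ (res P)     = res (ren (ext ρ) P)
ren ρ (rep P)     = rep (ren ρ P)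

shift : Proc n → Proc (suc n)
shift = ren suc

shiftT : Tuple n → Tuple (suc n)
shiftT = map⁺ suc

sub0 : Fin n → Fin (suc n) → Fin n
sub0 b zero    = b
sub0 b (suc i) = i

_[_/0] : Proc (suc n) → Fin n → Proc n
P [ b /0] = ren (sub0 b) P

swap01 : Fin (suc (suc n)) → Fin (suc (suc n))
swap01 zero          = suc zero
swap01 (suc zero)    = zero
swap01 (suc (suc i)) = suc (suc i)

-- Actions (early style).  Act n m: source scope n, target scope m.
data Act (n : ℕ) : ℕ → Set where
  τ    : Act n n
  ain  : Tuple n → Fin n → Act n n
  aout : Tuple n → Fin n → Act n n
  bout : Tuple n → Act n (suc n)          -- bound output ā⟨νx⟩ (x = index 0 of target)

Visible : Act n m → Set
Visible τ          = ⊥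
Visible (ain _ _)  = ⊤
Visible (aout _ _) = ⊤
Visible (bout _)   = ⊤

wk : Act n m → Proc n → Proc m
wk τ          Q = Q
wk (ain _ _)  Q = Q
wk (aout _ _) Q = Q
wk (bout _)   Q = shift Q

-- Labelled transition system (early semantics); an input and an output
-- synchronise only if their subject tuples coincide.
infix 4 _—[_]→_
data _—[_]→_ {n : ℕ} : {m : ℕ} → Proc n → Act n m → Proc m → Set where
  pre-τ   : ∀ {P} → tau P —[ τ ]→ P
  pre-in  : ∀ {a b P} → inp a P —[ ain a b ]→ P [ b /0]
  pre-out : ∀ {a b P} → out a b P —[ aout a b ]→ P
  sumˡ    : ∀ {m} {α : Act n m} {P Q P'} → P —[ α ]→ P' → sum P Q —[ α ]→ P'
  sumʳ    : ∀ {m} {α : Act n m} {P Q Q'} → Q —[ α ]→ Q' → sum P Q —[ α ]→ Q'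
  parˡ    : ∀ {m} {α : Act n m} {P Q P'} → P —[ α ]→ P' → par P Q —[ α ]→ par P' (wk α Q)
  parʳ    : ∀ {m} {α : Act n m} {P Q Q'} → Q —[ α ]→ Q' → par P Q —[ α ]→ par (wk α P) Q'
  comˡ    : ∀ {a b P Q P' Q'} → P —[ aout a b ]→ P' → Q —[ ain a b ]→ Q' →
            par P Q —[ τ ]→ par P' Q'
  comʳ    : ∀ {a b P Q P' Q'} → P —[ ain a b ]→ P' → Q —[ aout a b ]→ Q' →
            par P Q —[ τ ]→ par P' Q'
  closeˡ  : ∀ {a P Q P' Q'} → P —[ bout a ]→ P' → shift Q —[ ain (shiftT a) zero ]→ Q' →
            par P Q —[ τ ]→ res (par P' Q')
  closeʳ  : ∀ {a P Q P' Q'} → shift P —[ ain (shiftT a) zero ]→ P' → Q —[ bout a ]→ Q' →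
            par P Q —[ τ ]→ res (par P' Q')
  res-τ   : ∀ {P P'} → P —[ τ ]→ P' → res P —[ τ ]→ res P'
  res-in  : ∀ {a b P P'} → P —[ ain (shiftT a) (suc b) ]→ P' → res P —[ ain a b ]→ res P'
  res-out : ∀ {a b P P'} → P —[ aout (shiftT a) (suc b) ]→ P' → res P —[ aout a b ]→ res P'
  res-bout : ∀ {a P P'} → P —[ bout (shiftT a) ]→ P' → res P —[ bout a ]→ res (ren swap01 P')
  open'   : ∀ {a P P'} → P —[ aout (shiftT a) zero ]→ P' → res P —[ bout a ]→ P'
  rep'    : ∀ {m} {α : Act n m} {P P'} → par P (rep P) —[ α ]→ P' → rep P —[ α ]→ P'

_⇒_ : Proc n → Proc n → Set
_⇒_ {n} = Star (λ P Q → P —[ τ ]→ Q)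

_⇓ : Proc n → Set
_⇓ {n} P = Σ ℕ λ m → Σ (Act n m) λ α → Visible α ×
  Σ (Proc n) λ P₁ → Σ (Proc m) λ P₂ → Σ (Proc m) λ P₃ →
  (P ⇒ P₁) × (P₁ —[ α ]→ P₂) × (P₂ ⇒ P₃)

Invisible : Proc n → Set
Invisible P = ¬ (P ⇓)

-- Contexts with one hole: Ctx n m has overall scope n, hole at scope m
-- (hole filling may capture names, as in the paper).
data Ctx (n : ℕ) : ℕ → Set where
  hole  : Ctx n n
  tauC  : Ctx n m → Ctx n m
  inpC  : Tuple n → Ctx (suc n) m → Ctx n m
  outC  : Tuple n → Fin n → Ctx n m → Ctx n m
  sumˡC : Ctx n m → Proc n → Ctx n m
  sumʳC : Proc n → Ctx n m → Ctx n m
  parˡC : Ctx n m → Proc n → Ctx n m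
  parʳC : Proc n → Ctx n m → Ctx n m
  resC  : Ctx (suc n) m → Ctx n m
  repC  : Ctx n m → Ctx n m

_⟦_⟧ : Ctx n m → Proc m → Proc n
hole      ⟦ P ⟧ = P
tauC C    ⟦ P ⟧ = tau (C ⟦ P ⟧)
inpC a C  ⟦ P ⟧ = inp a (C ⟦ P ⟧)
outC a b C ⟦ P ⟧ = out a b (C ⟦ P ⟧)
sumˡC C Q ⟦ P ⟧ = sum (C ⟦ P ⟧) Q
sumʳC Q C ⟦ P ⟧ = sum Q (C ⟦ P ⟧)
parˡC C Q ⟦ P ⟧ = par (C ⟦ P ⟧) Q
parʳC Q C ⟦ P ⟧ = par Q (C ⟦ P ⟧)
resC C    ⟦ P ⟧ = res (C ⟦ P ⟧)
repC C    ⟦ P ⟧ = rep (C ⟦ P ⟧)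

-- I₀ = (νy)(‾⟨y,z⟩⟨y⟩ | ⟨y,c⟩(w).c̄⟨c⟩) is invisible: y is private, and its two
-- components cannot synchronise because their subjects ⟨y,z⟩ and ⟨y,c⟩ differ.
-- The context C₀ = (νa)(ā⟨c⟩ | a(z).[ ]) substitutes c for z, after which they do
-- synchronise and release the barb c̄⟨c⟩.  Filled with 0, the context performs
-- its single internal communication and stops.
module Submission where

open import Defs
open import Data.Nat using (ℕ; suc)
open import Data.Fin using (#_)
open import Data.List using ([]; _∷_)
open import Data.List.NonEmpty using (_∷_; [_])
open import Data.Product using (Σ; _×_; _,_)
open import Data.Unit using (tt)
open import Data.Empty using (⊥-elim)
open import Relation.Nullary using (¬_)
open import Relation.Binary.Construct.Closure.ReflexiveTransitive using (ε; _◅_)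

private variable
  n : ℕ

Stuck : Proc n → Set
Stuck {n} P = ∀ {m} {α : Act n m} {Q} → ¬ (P —[ α ]→ Q)

NoVisibleStep : Proc n → Set
NoVisibleStep {n} P = ∀ {m} {α : Act n m} {Q} → Visible α → ¬ (P —[ α ]→ Q)

invisible-if-τ-successors-invisible : {P : Proc n} → NoVisibleStep P →
  (∀ {Q} → P —[ τ ]→ Q → Invisible Q) → Invisible P
invisible-if-τ-successors-invisible noVis τ-inv (_ , _ , v , _ , _ , _ , ε , step , _) =
  noVis v step
invisible-if-τ-successors-invisible noVis τ-inv (m , α , v , P₁ , P₂ , P₃ , t ◅ ts , step , ts') =
  τ-inv t (m , α , v , P₁ , P₂ , P₃ , ts , step , ts')

stuck⇒invisible : {P : Proc n} → Stuck P → Invisible P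
stuck⇒invisible stuck = invisible-if-τ-successors-invisible (λ _ → stuck) (λ t → ⊥-elim (stuck t))

nil-stuck : Stuck {n} nil
nil-stuck ()

par-stuck : {P Q : Proc n} → Stuck P → Stuck Q → Stuck (par P Q)
par-stuck P-stuck Q-stuck (parˡ t)     = P-stuck t
par-stuck P-stuck Q-stuck (parʳ t)     = Q-stuck t
par-stuck P-stuck Q-stuck (comˡ t _)   = P-stuck t
par-stuck P-stuck Q-stuck (comʳ t _)   = P-stuck t
par-stuck P-stuck Q-stuck (closeˡ t _) = P-stuck t
par-stuck P-stuck Q-stuck (closeʳ _ t) = Q-stuck t

res-stuck : {P : Proc (suc n)} → Stuck P → Stuck (res P)
res-stuck P-stuck (res-τ t)    = P-stuck t
res-stuck P-stuck (res-in t)   = P-stuck t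
res-stuck P-stuck (res-out t)  = P-stuck t
res-stuck P-stuck (res-bout t) = P-stuck t
res-stuck P-stuck (open' t)    = P-stuck t

-- Hole scope: # 0 = z (the received name), # 1 = a (the private channel), # 2 = c;
-- under the restriction of I₀, # 0 = y and these shift to # 1, # 2, # 3.
C₀ : Ctx 1 3
C₀ = resC (parʳC (out [ # 0 ] (# 1) nil) (inpC [ # 0 ] hole))

I₀ : Proc 3
I₀ = res (par (out (# 0 ∷ # 1 ∷ []) (# 0) nil) (inp (# 0 ∷ # 3 ∷ []) (out [ # 4 ] (# 4) nil)))

I₀-stuck : Stuck I₀
I₀-stuck (res-τ (comˡ pre-out ()))
I₀-stuck (res-τ (comʳ () _))
I₀-stuck (res-τ (closeˡ () _))
I₀-stuck (res-τ (closeʳ () _))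
I₀-stuck (res-in {a = _ ∷ _} (parˡ ()))
I₀-stuck (res-in {a = _ ∷ _} (parʳ ()))
I₀-stuck (res-out {a = _ ∷ _} (parˡ ()))
I₀-stuck (res-out {a = _ ∷ _} (parʳ ()))
I₀-stuck (res-bout {a = _ ∷ _} (parˡ ()))
I₀-stuck (res-bout {a = _ ∷ _} (parʳ ()))
I₀-stuck (open' {a = _ ∷ _} (parˡ ()))
I₀-stuck (open' {a = _ ∷ _} (parʳ ()))

C₀⟦I₀⟧⇓ : (C₀ ⟦ I₀ ⟧) ⇓
C₀⟦I₀⟧⇓ = _ , _ , tt , _ , _ , _ ,
  res-τ (comˡ pre-out pre-in) ◅ res-τ (parʳ (res-τ (comˡ pre-out pre-in))) ◅ ε ,
  res-out (parʳ (res-out (parʳ pre-out))) ,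
  ε

C₀⟦nil⟧-no-visible-step : NoVisibleStep (C₀ ⟦ nil ⟧)
C₀⟦nil⟧-no-visible-step () (res-τ _)
C₀⟦nil⟧-no-visible-step _ (res-in {a = _ ∷ _} (parˡ ()))
C₀⟦nil⟧-no-visible-step _ (res-in {a = _ ∷ _} (parʳ ()))
C₀⟦nil⟧-no-visible-step _ (res-out {a = _ ∷ _} (parˡ ()))
C₀⟦nil⟧-no-visible-step _ (res-out {a = _ ∷ _} (parʳ ()))
C₀⟦nil⟧-no-visible-step _ (res-bout {a = _ ∷ _} (parˡ ()))
C₀⟦nil⟧-no-visible-step _ (res-bout {a = _ ∷ _} (parʳ ()))
C₀⟦nil⟧-no-visible-step _ (open' {a = _ ∷ _} (parˡ ()))
C₀⟦nil⟧-no-visible-step _ (open' {a = _ ∷ _} (parʳ ()))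

C₀⟦nil⟧-τ-successors-invisible : ∀ {Q} → C₀ ⟦ nil ⟧ —[ τ ]→ Q → Invisible Q
C₀⟦nil⟧-τ-successors-invisible (res-τ (comˡ pre-out pre-in)) =
  stuck⇒invisible (res-stuck (par-stuck nil-stuck nil-stuck))
C₀⟦nil⟧-τ-successors-invisible (res-τ (comʳ () _))
C₀⟦nil⟧-τ-successors-invisible (res-τ (closeˡ () _))
C₀⟦nil⟧-τ-successors-invisible (res-τ (closeʳ () _))
C₀⟦nil⟧-τ-successors-invisible (res-τ (parˡ ()))
C₀⟦nil⟧-τ-successors-invisible (res-τ (parʳ ()))

proposition4p2 : Σ ℕ λ n → Σ ℕ λ m → Σ (Ctx n m) λ C → Σ (Proc m) λ I → Σ (Proc m) λ P →
    Invisible I × (C ⟦ I ⟧) ⇓ × ¬ ((C ⟦ P ⟧) ⇓)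
proposition4p2 =
  1 , 3 , C₀ , I₀ , nil ,
  stuck⇒invisible I₀-stuck ,
  C₀⟦I₀⟧⇓ ,
  invisible-if-τ-successors-invisible C₀⟦nil⟧-no-visible-step C₀⟦nil⟧-τ-successors-invisible
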